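{- Let $A=\{a_1\le\dots\le a_n\}$ be a sorted multiset of positive integers and $p$ an integer with $1\le p\le n-k+1$. Let $Q=\sum_{i=1}^pa_i$ and $q=\max\{i\mid a_i\le Q\}$. Then the $k$-SSR$_R$ instance $(A,p)$ has an optimal solution $(S_1,\dots,S_k)$ satisfying: (1) every set $S_i$ containing only elements $j$ with $a_j\le Q$ satisfies $\Sigma(S_i,A)<2Q$; (2) every set $S_i$ containing an element $j$ with $a_j>Q$ is a singleton; (3) the union of the singleton sets $\{j\}$ of the solution with $a_j>Q$ equals $\bigcup_{i=1}^x\{q+i\}$, where $x\ge0$ is the number of these singleton sets.
   Context: $k\ge2$ is a fixed integer, $[n]=\{1,\dots,n\}$. For $S\subseteq[n]$, $\Sigma(S,A)=\sum_{i\in S}a_i$. For pairwise disjoint $S_1,\dots,S_k\subseteq[n]$, with $M=\max_i\Sigma(S_i,A)$ and $m=\min_i\Sigma(S_i,A)$, the ratio $\mathcal{R}(S_1,\dots,S_k,A)$ is $M/m$ if $m>0$ and $+\infty$ if $m=0$. The $k$-SSR$_R$ problem: given sorted $A$ and integer $p$ with $1\le p\le n-k+1$, find pairwise disjoint $S_1,\dots,S_k\subseteq[n]$ with $\max(S_1)=p$ and $\max(S_i)>p$ for $1<i\le k$ minimizing $\mathcal{R}(S_1,\dots,S_k,A)$. Elements of sets are indices in $[n]$. -}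

module Defs where

open import Data.Nat using (ℕ; zero; suc; _+_; _*_; _≤_; _<_; _⊔_; _⊓_)
open import Data.Nat.Properties using (_<?_)
open import Data.Bool using (Bool; true; false; if_then_else_)
open import Data.Bool.Properties using () renaming (_≟_ to _≟ᵇ_)
open import Data.Fin using (Fin; toℕ) renaming (zero to fzero; suc to fsuc)
open import Data.Fin.Properties using (any?)
open import Data.Fin.Subset using (Subset; _∈_; ⁅_⁆)
open import Data.Vec using (Vec; lookup; zipWith; sum; tabulate; count)
open import Data.Vec.Properties using (≡-dec)
open import Data.Product using (Σ; ∃; _×_; _,_)
open import Data.Sum using (_⊎_)
open import Relation.Nullary using (¬_; Dec)
open import Relation.Nullary.Decidable using (_×-dec_)
open import Relation.Binary.PropositionalEquality using (_≡_; _≢_)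

-- Indices: an element j : Fin n stands for the (1-based) index idx j = toℕ j + 1 ∈ [n].

idx : {n : ℕ} → Fin n → ℕ
idx j = suc (toℕ j)

Σ[_,_] : {n : ℕ} → Subset n → Vec ℕ n → ℕ
Σ[ S , A ] = sum (zipWith (λ b x → if b then x else 0) S A)

Sorted : {n : ℕ} → Vec ℕ n → Set
Sorted {n} A = (i j : Fin n) → toℕ i ≤ toℕ j → lookup A i ≤ lookup A j

Positive : {n : ℕ} → Vec ℕ n → Set
Positive {n} A = (j : Fin n) → 0 < lookup A j

MaxIs : {n : ℕ} → Subset n → ℕ → Set
MaxIs {n} S m = Σ (Fin n) (λ j → j ∈ S × idx j ≡ m) × ((j : Fin n) → j ∈ S → idx j ≤ m)

-- maximum and minimum of k values (k ≥ 1; the value for k = 0 is irrelevant, k ≥ 2 below)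
maxF : {k : ℕ} → (Fin k → ℕ) → ℕ
maxF {zero} f = 0
maxF {suc k} f = f fzero ⊔ maxF (λ i → f (fsuc i))

minF : {k : ℕ} → (Fin k → ℕ) → ℕ
minF {zero} f = 0
minF {suc zero} f = f fzero
minF {suc (suc k)} f = f fzero ⊓ minF (λ i → f (fsuc i))

Mx : {n k : ℕ} → (Fin k → Subset n) → Vec ℕ n → ℕ
Mx S A = maxF (λ i → Σ[ S i , A ])

Mn : {n k : ℕ} → (Fin k → Subset n) → Vec ℕ n → ℕ
Mn S A = minF (λ i → Σ[ S i , A ])

-- Comparison of ratios  R(S,A) ≤ R(T,A)  in [0, +∞]:
-- R = M/m if m > 0 and +∞ if m = 0.  For finite values M/m ≤ M'/m' ⇔ M·m' ≤ M'·m.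
RatioLe : ℕ → ℕ → ℕ → ℕ → Set
RatioLe M m M' m' = m' ≡ 0 ⊎ (m ≢ 0 × M * m' ≤ M' * m)

_≤ᴿ_ : {n k : ℕ} → (Fin k → Subset n) × Vec ℕ n → (Fin k → Subset n) × Vec ℕ n → Set
(S , A) ≤ᴿ (T , B) = RatioLe (Mx S A) (Mn S A) (Mx T B) (Mn T B)

-- Feasible solutions of the k-SSR_R instance (A, p); S_1 is the set with index toℕ i ≡ 0.
Feasible : {n k : ℕ} → Vec ℕ n → ℕ → (Fin k → Subset n) → Set
Feasible {n} {k} A p S =
  ((i i' : Fin k) → i ≢ i' → (j : Fin n) → j ∈ S i → ¬ (j ∈ S i'))
  × ((i : Fin k) → toℕ i ≡ 0 → MaxIs (S i) p)
  × ((i : Fin k) → 0 < toℕ i → ∃ λ m → MaxIs (S i) m × p < m)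

Optimal : {n k : ℕ} → Vec ℕ n → ℕ → (Fin k → Subset n) → Set
Optimal {n} {k} A p S =
  Feasible A p S × ((T : Fin k → Subset n) → Feasible A p T → (S , A) ≤ᴿ (T , A))

Qsum : {n : ℕ} → Vec ℕ n → ℕ → ℕ
Qsum A p = sum (zipWith (λ j x → if toℕ j Data.Nat.<ᵇ p then x else 0) (tabulate (λ j → j)) A)

IsQIndex : {n : ℕ} → Vec ℕ n → ℕ → ℕ → Set
IsQIndex {n} A Q q =
  Σ (Fin n) (λ j → idx j ≡ q × lookup A j ≤ Q) × ((j : Fin n) → lookup A j ≤ Q → idx j ≤ q)

BigSingleton : {n : ℕ} → Vec ℕ n → ℕ → Subset n → Set
BigSingleton {n} A Q S = ∃ λ (j : Fin n) → S ≡ ⁅ j ⁆ × Q < lookup A j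

bigSingleton? : {n : ℕ} (A : Vec ℕ n) (Q : ℕ) (S : Subset n) → Dec (BigSingleton A Q S)
bigSingleton? A Q S = any? (λ j → ≡-dec _≟ᵇ_ S ⁅ j ⁆ ×-dec (Q <? lookup A j))

numBig : {n k : ℕ} → Vec ℕ n → ℕ → (Fin k → Subset n) → ℕ
numBig A Q S = count (bigSingleton? A Q) (tabulate S)

-- Among the optimal solutions choose one of least potential Φ(S) = Σᵢ Σ_{j ∈ Sᵢ} j; both minima exist
-- since there are finitely many solutions. Any violation of (1)–(3) lets us replace a single set Sᵢ,
-- i > 1, so that the solution stays feasible, M does not grow, m does not shrink and Φ drops:
-- a light set with sum ≥ 2Q loses an element other than its maximum and keeps a sum ≥ Q ≥ Σ(S₁) ≥ m;
-- a set containing a big element j (a_j > Q) becomes {j}; a big singleton {j} becomes {j′} for a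
-- big j′ < j outside all big singletons, hence (by (2)) outside all sets. So the big singletons
-- occupy a downward closed set of indices above q, which is the interval (q, q + x].

module Submission where

open import Defs
open import Data.Bool using (if_then_else_)
open import Data.Fin using (Fin; toℕ; fromℕ<) renaming (zero to fzero; suc to fsuc; _≟_ to _≟ᶠ_)
open import Data.Fin.Properties using (toℕ-injective; toℕ-fromℕ<; toℕ<n; any?; all?) renaming (suc-injective to fsuc-injective)
open import Data.Fin.Subset using (Subset; _∈_; _∉_; _⊆_; ⁅_⁆; _-_; ⊥; ⊤; ∣_∣; inside; outside)
open import Data.Fin.Subset.Properties
  using (_∈?_; x∈⁅y⁆⇒x≡y; x∈⁅x⁆; x∈p∧x≢y⇒x∈p-y; x∈p⇒∣p-x∣<∣p∣; ∣⊤∣≡n; p─⊥≡p; p─q⊆p; drop-∷-⊆; ∈⊤; ⊆-antisym)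
open import Data.List using (List; []; _∷_; [_]; map; cartesianProductWith)
open import Data.List.Membership.Propositional using () renaming (_∈_ to _∈ₗ_)
open import Data.List.Membership.Propositional.Properties using (∈-cartesianProductWith⁺; ∈-map⁺)
open import Data.List.Relation.Unary.All using (All; []; _∷_)
import Data.List.Relation.Unary.All as All
open import Data.List.Relation.Unary.Any using () renaming (here to hereₗ; there to thereₗ)
open import Data.Nat using (ℕ; zero; suc; _+_; _*_; _∸_; _≤_; _<_; _⊔_; _⊓_; z≤n; s≤s; z<s; s≤s⁻¹; _≟_; _≤?_; _<?_; ≢-nonZero)
open import Data.Nat.Properties
open import Data.Product using (∃; _×_; _,_; proj₁; proj₂)
open import Data.Sum using (_⊎_; inj₁; inj₂)
open import Data.Vec using (Vec; []; _∷_; lookup; sum; tabulate; count; zipWith; here; there)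
open import Data.Vec.Functional using (updateAt)
open import Data.Vec.Functional.Properties using (updateAt-updates; updateAt-minimal)
open import Data.Vec.Properties using (lookup∘tabulate; []=⇒lookup; lookup⇒[]=; tabulate-∘; zipWith-map₁; tabulate-cong)
open import Algebra.Properties.CommutativeSemigroup *-commutativeSemigroup using () renaming (xy∙z≈xz∙y to *-rightComm)
open import Function using (_∘_; const; _on_; case_of_; _⇔_; mk⇔; Equivalence)
open import Level using (Level; 0ℓ)
open import Relation.Binary using (Rel; Total; Transitive)
open import Relation.Binary.PropositionalEquality using (_≡_; _≢_; _≗_; refl; sym; trans; cong; cong₂; subst; subst₂)
open import Relation.Nullary using (¬_; ¬?; Dec; yes; no; does; contradiction; _×-dec_; _⊎-dec_; _→-dec_)
open import Relation.Nullary.Decidable using (dec-true; map′; decidable-stable)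
open import Relation.Unary using (Pred; Decidable)

private
  variable
    a ℓ : Level
    X : Set a
    m n : ℕ

vectors : List X → (m : ℕ) → List (Vec X m)
vectors xs zero = [ [] ]
vectors xs (suc m) = cartesianProductWith _∷_ xs (vectors xs m)

∈-vectors : {xs : List X} → (∀ x → x ∈ₗ xs) → (v : Vec X m) → v ∈ₗ vectors xs m
∈-vectors xs-complete [] = hereₗ refl
∈-vectors xs-complete (x ∷ v) = ∈-cartesianProductWith⁺ _∷_ (xs-complete x) (∈-vectors xs-complete v)

subsets : (n : ℕ) → List (Subset n)
subsets = vectors (inside ∷ outside ∷ [])

∈-subsets : (S : Subset n) → S ∈ₗ subsets n
∈-subsets = ∈-vectors λ { inside → hereₗ refl ; outside → thereₗ (hereₗ refl) }

functions : List X → (m : ℕ) → List (Fin m → X)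
functions xs m = map lookup (vectors xs m)

∈-functions : {xs : List X} → (∀ x → x ∈ₗ xs) → (f : Fin m → X) →
  ∃ λ g → g ∈ₗ functions xs m × g ≗ f
∈-functions xs-complete f =
  lookup (tabulate f) , ∈-map⁺ lookup (∈-vectors xs-complete (tabulate f)) , lookup∘tabulate f

-- Minimisation along a total preorder

total⇒reflexive : (_≼_ : Rel X ℓ) → Total _≼_ → ∀ x → x ≼ x
total⇒reflexive _≼_ ≼-total x with ≼-total x x
... | inj₁ x≼x = x≼x
... | inj₂ x≼x = x≼x

module _ (_≼_ : Rel X ℓ) (≼-total : Total _≼_) (≼-trans : Transitive _≼_) where

  least : ∀ {P : Pred X ℓ} → Decidable P → ∀ {x₀} → P x₀ → (xs : List X) →
    ∃ λ x → P x × x ≼ x₀ × All (λ y → P y → x ≼ y) xs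
  least P? {x₀} Px₀ [] = x₀ , Px₀ , total⇒reflexive _≼_ ≼-total x₀ , []
  least P? Px₀ (y ∷ ys) with least P? Px₀ ys | P? y
  ... | x , Px , x≼x₀ , x≼ys | no ¬Py = x , Px , x≼x₀ , (λ Py → contradiction Py ¬Py) ∷ x≼ys
  ... | x , Px , x≼x₀ , x≼ys | yes Py with ≼-total x y
  ...   | inj₁ x≼y = x , Px , x≼x₀ , (λ _ → x≼y) ∷ x≼ys
  ...   | inj₂ y≼x = y , Py , ≼-trans y≼x x≼x₀ ,
                      (λ _ → total⇒reflexive _≼_ ≼-total y) ∷ All.map (λ x≼z Pz → ≼-trans y≼x (x≼z Pz)) x≼ys

updateAt-elim : ∀ {b} (xs : Fin n → X) (i : Fin n) (f : X → X) (P : Fin n → X → Set b) →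
  P i (f (xs i)) → (∀ i′ → i′ ≢ i → P i′ (xs i′)) → ∀ i′ → P i′ (updateAt xs i f i′)
updateAt-elim xs i f P Pi Pothers i′ with i′ ≟ᶠ i
... | yes refl = subst (P i) (sym (updateAt-updates i xs)) Pi
... | no i′≢i = subst (P i′) (sym (updateAt-minimal i′ i xs i′≢i)) (Pothers i′ i′≢i)

maxF-ub : (f : Fin m → ℕ) (i : Fin m) → f i ≤ maxF f
maxF-ub f fzero = m≤m⊔n _ _
maxF-ub f (fsuc i) = ≤-trans (maxF-ub (f ∘ fsuc) i) (m≤n⊔m _ _)

maxF-lub : (f : Fin m → ℕ) {c : ℕ} → (∀ i → f i ≤ c) → maxF f ≤ c
maxF-lub {zero} f f≤c = z≤n
maxF-lub {suc m} f f≤c = ⊔-lub (f≤c fzero) (maxF-lub (f ∘ fsuc) (f≤c ∘ fsuc))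

maxF-cong : {f g : Fin m → ℕ} → f ≗ g → maxF f ≡ maxF g
maxF-cong {zero} f≗g = refl
maxF-cong {suc m} f≗g = cong₂ _⊔_ (f≗g fzero) (maxF-cong (f≗g ∘ fsuc))

minF-lb : (f : Fin (suc m) → ℕ) (i : Fin (suc m)) → minF f ≤ f i
minF-lb {zero} f fzero = ≤-refl
minF-lb {suc m} f fzero = m⊓n≤m _ _
minF-lb {suc m} f (fsuc i) = ≤-trans (m⊓n≤n _ _) (minF-lb (f ∘ fsuc) i)

minF-glb : (f : Fin (suc m) → ℕ) {c : ℕ} → (∀ i → c ≤ f i) → c ≤ minF f
minF-glb {zero} f c≤f = c≤f fzero
minF-glb {suc m} f c≤f = ⊓-glb (c≤f fzero) (minF-glb (f ∘ fsuc) (c≤f ∘ fsuc))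

minF-cong : {f g : Fin m → ℕ} → f ≗ g → minF f ≡ minF g
minF-cong {zero} f≗g = refl
minF-cong {suc zero} f≗g = f≗g fzero
minF-cong {suc (suc m)} f≗g = cong₂ _⊓_ (f≗g fzero) (minF-cong (f≗g ∘ fsuc))

sum-tabulate-mono-≤ : {f g : Fin m → ℕ} → (∀ i → f i ≤ g i) → sum (tabulate f) ≤ sum (tabulate g)
sum-tabulate-mono-≤ {zero} f≤g = z≤n
sum-tabulate-mono-≤ {suc m} f≤g = +-mono-≤ (f≤g fzero) (sum-tabulate-mono-≤ (f≤g ∘ fsuc))

sum-tabulate-mono-< : {f g : Fin m → ℕ} → (∀ i → f i ≤ g i) → ∀ i → f i < g i →
  sum (tabulate f) < sum (tabulate g)
sum-tabulate-mono-< f≤g fzero fi<gi = +-mono-<-≤ fi<gi (sum-tabulate-mono-≤ (f≤g ∘ fsuc))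
sum-tabulate-mono-< f≤g (fsuc i) fi<gi = +-mono-≤-< (f≤g fzero) (sum-tabulate-mono-< (f≤g ∘ fsuc) i fi<gi)

-- Ratios in [0, ∞]

RatioLe-total : ∀ M m M′ m′ → RatioLe M m M′ m′ ⊎ RatioLe M′ m′ M m
RatioLe-total M m M′ m′ with m′ ≟ 0 | m ≟ 0
... | yes m′≡0 | _ = inj₁ (inj₁ m′≡0)
... | no _ | yes m≡0 = inj₂ (inj₁ m≡0)
... | no m′≢0 | no m≢0 with ≤-total (M * m′) (M′ * m)
...   | inj₁ le = inj₁ (inj₂ (m≢0 , le))
...   | inj₂ ge = inj₂ (inj₂ (m′≢0 , ge))

RatioLe-trans : ∀ {M₁ m₁ M₂ m₂ M₃ m₃} →
  RatioLe M₁ m₁ M₂ m₂ → RatioLe M₂ m₂ M₃ m₃ → RatioLe M₁ m₁ M₃ m₃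
RatioLe-trans _ (inj₁ m₃≡0) = inj₁ m₃≡0
RatioLe-trans (inj₁ m₂≡0) (inj₂ (m₂≢0 , _)) = contradiction m₂≡0 m₂≢0
RatioLe-trans {M₁} {m₁} {M₂} {m₂} {M₃} {m₃} (inj₂ (m₁≢0 , le₁₂)) (inj₂ (m₂≢0 , le₂₃)) =
  inj₂ (m₁≢0 , *-cancelʳ-≤ (M₁ * m₃) (M₃ * m₁) m₂ {{≢-nonZero m₂≢0}} (begin
    M₁ * m₃ * m₂ ≡⟨ *-rightComm M₁ m₃ m₂ ⟩
    M₁ * m₂ * m₃ ≤⟨ *-monoˡ-≤ m₃ le₁₂ ⟩
    M₂ * m₁ * m₃ ≡⟨ *-rightComm M₂ m₁ m₃ ⟩
    M₂ * m₃ * m₁ ≤⟨ *-monoˡ-≤ m₁ le₂₃ ⟩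
    M₃ * m₂ * m₁ ≡⟨ *-rightComm M₃ m₂ m₁ ⟩
    M₃ * m₁ * m₂ ∎))
  where open ≤-Reasoning

RatioLe-mono : ∀ {M m M′ m′} → M′ ≤ M → m ≤ m′ → RatioLe M′ m′ M m
RatioLe-mono {m = m} M′≤M m≤m′ with m ≟ 0
... | yes m≡0 = inj₁ m≡0
... | no m≢0 = inj₂ ((λ m′≡0 → m≢0 (n≤0⇒n≡0 (subst (_ ≤_) m′≡0 m≤m′))) , *-mono-≤ M′≤M m≤m′)

RatioLe? : ∀ M m M′ m′ → Dec (RatioLe M m M′ m′)
RatioLe? M m M′ m′ = (m′ ≟ 0) ⊎-dec (¬? (m ≟ 0) ×-dec (M * m′ ≤? M′ * m))

Σ-⊥ : (A : Vec ℕ n) → Σ[ ⊥ , A ] ≡ 0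
Σ-⊥ [] = refl
Σ-⊥ (a ∷ A) = Σ-⊥ A

Σ-⁅⁆ : (A : Vec ℕ n) (j : Fin n) → Σ[ ⁅ j ⁆ , A ] ≡ lookup A j
Σ-⁅⁆ (a ∷ A) fzero = trans (cong (a +_) (Σ-⊥ A)) (+-identityʳ a)
Σ-⁅⁆ (a ∷ A) (fsuc j) = Σ-⁅⁆ A j

Σ-mono-⊆ : {S T : Subset n} (A : Vec ℕ n) → S ⊆ T → Σ[ S , A ] ≤ Σ[ T , A ]
Σ-mono-⊆ {S = []} {[]} [] S⊆T = z≤n
Σ-mono-⊆ {S = outside ∷ S} {outside ∷ T} (a ∷ A) S⊆T = Σ-mono-⊆ A (drop-∷-⊆ S⊆T)
Σ-mono-⊆ {S = outside ∷ S} {inside ∷ T} (a ∷ A) S⊆T = ≤-trans (Σ-mono-⊆ A (drop-∷-⊆ S⊆T)) (m≤n+m _ a)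
Σ-mono-⊆ {S = inside ∷ S} {outside ∷ T} (a ∷ A) S⊆T with () ← S⊆T here
Σ-mono-⊆ {S = inside ∷ S} {inside ∷ T} (a ∷ A) S⊆T = +-monoʳ-≤ a (Σ-mono-⊆ A (drop-∷-⊆ S⊆T))

lookup≤Σ : {S : Subset n} (A : Vec ℕ n) {j : Fin n} → j ∈ S → lookup A j ≤ Σ[ S , A ]
lookup≤Σ {S = S} A {j} j∈S = subst (_≤ Σ[ S , A ]) (Σ-⁅⁆ A j) (Σ-mono-⊆ A ⁅j⁆⊆S)
  where
  ⁅j⁆⊆S : ⁅ j ⁆ ⊆ S
  ⁅j⁆⊆S x∈⁅j⁆ rewrite x∈⁅y⁆⇒x≡y j x∈⁅j⁆ = j∈S

Σ-remove : (S : Subset n) (A : Vec ℕ n) {j : Fin n} → j ∈ S → Σ[ S , A ] ≡ Σ[ S - j , A ] + lookup A j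
Σ-remove (inside ∷ S) (a ∷ A) here =
  trans (+-comm a Σ[ S , A ]) (cong (λ U → Σ[ U , A ] + a) (sym (p─⊥≡p S)))
Σ-remove (s ∷ S) (a ∷ A) {fsuc j} (there j∈S) =
  trans (cong ((if s then a else 0) +_) (Σ-remove S A j∈S)) (sym (+-assoc (if s then a else 0) _ _))

Σ-remove-< : (S : Subset n) (A : Vec ℕ n) {j : Fin n} → j ∈ S → 0 < lookup A j → Σ[ S - j , A ] < Σ[ S , A ]
Σ-remove-< S A {j} j∈S Aj>0 =
  subst (Σ[ S - j , A ] <_) (sym (Σ-remove S A j∈S)) (m<m+n Σ[ S - j , A ] Aj>0)

module _ {P : Pred (Fin n) ℓ} (P? : Decidable P) where

  subset : Subset n
  subset = tabulate (does ∘ P?)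

  ∈-subset⁺ : ∀ {j} → P j → j ∈ subset
  ∈-subset⁺ {j} Pj = lookup⇒[]= j subset (trans (lookup∘tabulate (does ∘ P?) j) (dec-true (P? j) Pj))

  ∈-subset⁻ : ∀ {j} → j ∈ subset → P j
  ∈-subset⁻ {j} j∈ with P? j | trans (sym (lookup∘tabulate (does ∘ P?) j)) ([]=⇒lookup j∈)
  ... | yes Pj | _ = Pj
  ... | no _ | ()

count-tabulate : {P : Pred X ℓ} (P? : Decidable P) (f : Fin m → X) →
  count P? (tabulate f) ≡ ∣ subset (P? ∘ f) ∣
count-tabulate {m = zero} P? f = refl
count-tabulate {m = suc m} P? f with P? (f fzero)
... | yes _ = cong suc (count-tabulate P? (f ∘ fsuc))
... | no _ = count-tabulate P? (f ∘ fsuc)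

∣p∣≤∣q∣-injective : {p : Subset m} {q : Subset n} (f : ∀ {i} → i ∈ p → Fin n) →
  (∀ {i} (i∈p : i ∈ p) → f i∈p ∈ q) →
  (∀ {i i′} (i∈p : i ∈ p) (i′∈p : i′ ∈ p) → f i∈p ≡ f i′∈p → i ≡ i′) →
  ∣ p ∣ ≤ ∣ q ∣
∣p∣≤∣q∣-injective {p = []} f f∈q f-inj = z≤n
∣p∣≤∣q∣-injective {p = outside ∷ p} f f∈q f-inj =
  ∣p∣≤∣q∣-injective (f ∘ there) (f∈q ∘ there) (λ i∈p i′∈p → fsuc-injective ∘ f-inj (there i∈p) (there i′∈p))
∣p∣≤∣q∣-injective {p = inside ∷ p} {q} f f∈q f-inj = begin-strict
  ∣ p ∣          ≤⟨ ∣p∣≤∣q∣-injective (f ∘ there) f∈q-f₀ (λ i∈p i′∈p → fsuc-injective ∘ f-inj (there i∈p) (there i′∈p)) ⟩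
  ∣ q - f here ∣ <⟨ x∈p⇒∣p-x∣<∣p∣ (f∈q here) ⟩
  ∣ q ∣          ∎
  where
  open ≤-Reasoning
  f∈q-f₀ : ∀ {i} (i∈p : i ∈ p) → f (there i∈p) ∈ q - f here
  f∈q-f₀ i∈p = x∈p∧x≢y⇒x∈p-y (f∈q (there i∈p)) (λ eq → case f-inj (there i∈p) here eq of λ ())

∣p∣≡∣q∣-matching : {p : Subset m} {q : Subset n} (R : Fin m → Fin n → Set ℓ) →
  (∀ {i} → i ∈ p → ∃ λ j → j ∈ q × R i j) →
  (∀ {j} → j ∈ q → ∃ λ i → i ∈ p × R i j) →
  (∀ {i i′ j} → R i j → R i′ j → i ≡ i′) →
  (∀ {i j j′} → R i j → R i j′ → j ≡ j′) →
  ∣ p ∣ ≡ ∣ q ∣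
∣p∣≡∣q∣-matching R p→q q→p R-injˡ R-injʳ = ≤-antisym
  (∣p∣≤∣q∣-injective (proj₁ ∘ p→q) (proj₁ ∘ proj₂ ∘ p→q)
    (λ i∈p i′∈p eq → R-injˡ (proj₂ (proj₂ (p→q i∈p))) (subst (R _) (sym eq) (proj₂ (proj₂ (p→q i′∈p))))))
  (∣p∣≤∣q∣-injective (proj₁ ∘ q→p) (proj₁ ∘ proj₂ ∘ q→p)
    (λ j∈q j′∈q eq → R-injʳ (proj₂ (proj₂ (q→p j∈q))) (subst (λ i → R i _) (sym eq) (proj₂ (proj₂ (q→p j′∈q))))))

lo+∣p∣≤hi : (p : Subset n) {lo hi : ℕ} → lo ≤ hi →
  (∀ {j} → j ∈ p → lo ≤ toℕ j × toℕ j < hi) → lo + ∣ p ∣ ≤ hi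
lo+∣p∣≤hi p {lo} {hi} lo≤hi p⊆range = subst (lo + ∣ p ∣ ≤_) (m+[n∸m]≡n lo≤hi) (+-monoʳ-≤ lo
  (subst (∣ p ∣ ≤_) (∣⊤∣≡n (hi ∸ lo)) (∣p∣≤∣q∣-injective shift (λ _ → ∈⊤) shift-injective)))
  where
  shifted< : ∀ {j} → j ∈ p → toℕ j ∸ lo < hi ∸ lo
  shifted< j∈p = ∸-monoˡ-< (proj₂ (p⊆range j∈p)) (proj₁ (p⊆range j∈p))
  shift : ∀ {j} → j ∈ p → Fin (hi ∸ lo)
  shift j∈p = fromℕ< (shifted< j∈p)
  shift-injective : ∀ {j j′} (j∈p : j ∈ p) (j′∈p : j′ ∈ p) → shift j∈p ≡ shift j′∈p → j ≡ j′
  shift-injective j∈p j′∈p eq = toℕ-injective (∸-cancelʳ-≡ (proj₁ (p⊆range j∈p)) (proj₁ (p⊆range j′∈p))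
    (trans (sym (toℕ-fromℕ< (shifted< j∈p))) (trans (cong toℕ eq) (toℕ-fromℕ< (shifted< j′∈p)))))

hi≤lo+∣p∣ : (p : Subset n) {lo hi : ℕ} → lo ≤ hi → hi ≤ n →
  (∀ j → lo ≤ toℕ j → toℕ j < hi → j ∈ p) → hi ≤ lo + ∣ p ∣
hi≤lo+∣p∣ {n} p {lo} {hi} lo≤hi hi≤n range⊆p = subst (_≤ lo + ∣ p ∣) (m+[n∸m]≡n lo≤hi) (+-monoʳ-≤ lo
  (subst (_≤ ∣ p ∣) (∣⊤∣≡n (hi ∸ lo)) (∣p∣≤∣q∣-injective shift shift∈p shift-injective)))
  where
  shifted<hi : (l : Fin (hi ∸ lo)) → lo + toℕ l < hi
  shifted<hi l = subst (lo + toℕ l <_) (m+[n∸m]≡n lo≤hi) (+-monoʳ-< lo (toℕ<n l))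
  shift : ∀ {l} → l ∈ ⊤ → Fin n
  shift {l} _ = fromℕ< (<-≤-trans (shifted<hi l) hi≤n)
  toℕ-shift : ∀ {l} (l∈⊤ : l ∈ ⊤) → toℕ (shift l∈⊤) ≡ lo + toℕ l
  toℕ-shift {l} _ = toℕ-fromℕ< (<-≤-trans (shifted<hi l) hi≤n)
  shift∈p : ∀ {l} (l∈⊤ : l ∈ ⊤) → shift l∈⊤ ∈ p
  shift∈p {l} l∈⊤ = range⊆p _
    (subst (lo ≤_) (sym (toℕ-shift l∈⊤)) (m≤m+n lo (toℕ l)))
    (subst (_< hi) (sym (toℕ-shift l∈⊤)) (shifted<hi l))
  shift-injective : ∀ {l l′} (l∈⊤ : l ∈ ⊤) (l′∈⊤ : l′ ∈ ⊤) → shift l∈⊤ ≡ shift l′∈⊤ → l ≡ l′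
  shift-injective {l} {l′} l∈⊤ l′∈⊤ eq = toℕ-injective (+-cancelˡ-≡ lo (toℕ l) (toℕ l′)
    (trans (sym (toℕ-shift l∈⊤)) (trans (cong toℕ eq) (toℕ-shift l′∈⊤))))

interval-of-downClosed : (B : Subset n) (q : ℕ) → q ≤ n →
  (∀ {j} → j ∈ B → q ≤ toℕ j) →
  (∀ {j j′} → j ∈ B → q ≤ toℕ j′ → toℕ j′ < toℕ j → j′ ∈ B) →
  q + ∣ B ∣ ≤ n × (∀ j → j ∈ B ⇔ (q ≤ toℕ j × toℕ j < q + ∣ B ∣))
interval-of-downClosed {n} B q q≤n B-above B-closed =
  lo+∣p∣≤hi B q≤n (λ {j} j∈B → B-above j∈B , toℕ<n j) , λ j → mk⇔ (in-interval j) (from-interval j)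
  where
  closed-≤ : ∀ {j j′} → j ∈ B → q ≤ toℕ j′ → toℕ j′ ≤ toℕ j → j′ ∈ B
  closed-≤ {j} {j′} j∈B q≤j′ j′≤j with toℕ j′ ≟ toℕ j
  ... | yes eq rewrite toℕ-injective eq = j∈B
  ... | no j′≢j = B-closed j∈B q≤j′ (≤∧≢⇒< j′≤j j′≢j)
  in-interval : ∀ j → j ∈ B → q ≤ toℕ j × toℕ j < q + ∣ B ∣
  in-interval j j∈B = B-above j∈B , hi≤lo+∣p∣ B (m≤n⇒m≤1+n (B-above j∈B)) (toℕ<n j)
    (λ j′ q≤j′ j′<1+j → closed-≤ j∈B q≤j′ (s≤s⁻¹ j′<1+j))
  from-interval : ∀ j → q ≤ toℕ j × toℕ j < q + ∣ B ∣ → j ∈ B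
  from-interval j (q≤j , j<q+∣B∣) with j ∈? B
  ... | yes j∈B = j∈B
  ... | no j∉B = contradiction j<q+∣B∣ (≤⇒≯ (lo+∣p∣≤hi B q≤j
    (λ {b} b∈B → B-above b∈B , ≰⇒> (λ j≤b → j∉B (closed-≤ b∈B q≤j j≤b)))))

module Instance {n k : ℕ} (A : Vec ℕ n) (p : ℕ) where

  Solution : Set
  Solution = Fin (suc k) → Subset n

  _≼_ : Rel Solution 0ℓ
  S ≼ T = (S , A) ≤ᴿ (T , A)

  ≼-total : Total _≼_
  ≼-total S T = RatioLe-total (Mx S A) (Mn S A) (Mx T A) (Mn T A)

  ≼-trans : Transitive _≼_
  ≼-trans {S} {T} {U} = RatioLe-trans {Mx S A} {Mn S A} {Mx T A} {Mn T A} {Mx U A} {Mn U A}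

  Mx-cong : ∀ {S S′ : Solution} → S ≗ S′ → Mx S A ≡ Mx S′ A
  Mx-cong S≗S′ = maxF-cong (λ i → cong (λ V → Σ[ V , A ]) (S≗S′ i))

  Mn-cong : ∀ {S S′ : Solution} → S ≗ S′ → Mn S A ≡ Mn S′ A
  Mn-cong S≗S′ = minF-cong (λ i → cong (λ V → Σ[ V , A ]) (S≗S′ i))

  ≼-respʳ-≗ : ∀ {S T T′ : Solution} → T ≗ T′ → S ≼ T → S ≼ T′
  ≼-respʳ-≗ {S} T≗T′ = subst₂ (RatioLe (Mx S A) (Mn S A)) (Mx-cong T≗T′) (Mn-cong T≗T′)

  ≼-respˡ-≗ : ∀ {S S′ T : Solution} → S ≗ S′ → S ≼ T → S′ ≼ T
  ≼-respˡ-≗ {T = T} S≗S′ = subst₂ (λ M m → RatioLe M m (Mx T A) (Mn T A)) (Mx-cong S≗S′) (Mn-cong S≗S′)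

  weights : Vec ℕ n
  weights = tabulate idx

  Φ : Solution → ℕ
  Φ S = sum (tabulate (λ i → Σ[ S i , weights ]))

  Φ-cong : ∀ {S S′} → S ≗ S′ → Φ S ≡ Φ S′
  Φ-cong S≗S′ = cong sum (tabulate-cong (λ i → cong (λ V → Σ[ V , weights ]) (S≗S′ i)))

  Feasible-resp-≗ : ∀ {S S′ : Solution} → S ≗ S′ → Feasible A p S → Feasible A p S′
  Feasible-resp-≗ {S} {S′} S≗S′ (disjoint , first , later) =
    (λ i i′ i≢i′ j j∈ j∈′ → disjoint i i′ i≢i′ j (subst (j ∈_) (sym (S≗S′ i)) j∈) (subst (j ∈_) (sym (S≗S′ i′)) j∈′)) ,
    (λ i i≡0 → subst (λ V → MaxIs V p) (S≗S′ i) (first i i≡0)) ,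
    (λ i i>0 → subst (λ V → ∃ λ m → MaxIs V m × p < m) (S≗S′ i) (later i i>0))

  MaxIs? : (U : Subset n) (m : ℕ) → Dec (MaxIs U m)
  MaxIs? U m = any? (λ j → (j ∈? U) ×-dec (idx j ≟ m)) ×-dec all? (λ j → (j ∈? U) →-dec (idx j ≤? m))

  MaxAbove? : (U : Subset n) → Dec (∃ λ m → MaxIs U m × p < m)
  MaxAbove? U = map′ (λ (j , max , p<j) → idx j , max , p<j) attained (any? λ j → MaxIs? U (idx j) ×-dec (p <? idx j))
    where
    attained : (∃ λ m → MaxIs U m × p < m) → ∃ λ j → MaxIs U (idx j) × p < idx j
    attained (m , max@((j , _ , j≡m) , _) , p<m) = j , subst (MaxIs U) (sym j≡m) max , subst (p <_) (sym j≡m) p<m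

  feasible? : (S : Solution) → Dec (Feasible A p S)
  feasible? S =
    all? (λ i → all? λ i′ → ¬? (i ≟ᶠ i′) →-dec all? λ j → (j ∈? S i) →-dec ¬? (j ∈? S i′)) ×-dec
    all? (λ i → (toℕ i ≟ 0) →-dec MaxIs? (S i) p) ×-dec
    all? (λ i → (0 <? toℕ i) →-dec MaxAbove? (S i))

  Improvement : Solution → Set
  Improvement S = ∃ λ T → Feasible A p T × T ≼ S × Φ T < Φ S

  solutions : List Solution
  solutions = functions (subsets n) (suc k)

  ≤-on-Φ-total : Total (_≤_ on Φ)
  ≤-on-Φ-total S T = ≤-total (Φ S) (Φ T)

  feasible-≼? : (S T : Solution) → Dec (Feasible A p T × T ≼ S)
  feasible-≼? S T = feasible? T ×-dec RatioLe? (Mx T A) (Mn T A) (Mx S A) (Mn S A)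

  All-solutions : {P : Solution → Set} → (∀ {S S′} → S ≗ S′ → P S → P S′) → All P solutions → ∀ S → P S
  All-solutions P-resp P-solutions S =
    let S′ , S′∈ , S′≗S = ∈-functions ∈-subsets S in P-resp S′≗S (All.lookup P-solutions S′∈)

  -- ≼-trans is η-expanded because its implicit arguments cannot be recovered by unfolding RatioLe.
  ratio-minimum : ∀ {S₀} → Feasible A p S₀ → ∃ λ S → Optimal A p S
  ratio-minimum feasible-S₀ =
    let S , feasible-S , _ , S≼solutions =
          least _≼_ ≼-total (λ {S} {T} {U} → ≼-trans {S} {T} {U}) feasible? feasible-S₀ solutions
    in S , feasible-S , All-solutions {λ T → Feasible A p T → S ≼ T}
         (λ {T} {T′} T≗T′ S≼T feasible-T′ → ≼-respʳ-≗ {S} {T} {T′} T≗T′ (S≼T (Feasible-resp-≗ (sym ∘ T≗T′) feasible-T′)))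
         S≼solutions

  Φ-minimum-below : ∀ {S*} → Feasible A p S* →
    ∃ λ S → Feasible A p S × S ≼ S* × (∀ T → Feasible A p T × T ≼ S* → Φ S ≤ Φ T)
  Φ-minimum-below {S*} feasible-S* =
    let S , (feasible-S , S≼S*) , _ , S≤solutions =
          least (_≤_ on Φ) ≤-on-Φ-total ≤-trans (feasible-≼? S*) (feasible-S* , total⇒reflexive _≼_ ≼-total S*) solutions
    in S , feasible-S , S≼S* , All-solutions {λ T → Feasible A p T × T ≼ S* → Φ S ≤ Φ T}
         (λ {T} {T′} T≗T′ S≤T (feasible-T′ , T′≼S*) → subst (Φ S ≤_) (Φ-cong T≗T′)
           (S≤T (Feasible-resp-≗ (sym ∘ T≗T′) feasible-T′ , ≼-respˡ-≗ {T′} {T} {S*} (sym ∘ T≗T′) T′≼S*)))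
         S≤solutions

  optimal-without-improvement : ∀ {S₀} → Feasible A p S₀ → ∃ λ S → Optimal A p S × ¬ Improvement S
  optimal-without-improvement feasible-S₀ =
    let S* , feasible-S* , S*-optimal = ratio-minimum feasible-S₀
        S , feasible-S , S≼S* , S-Φ-least = Φ-minimum-below feasible-S*
    in S , (feasible-S , λ T feasible-T → ≼-trans {S} {S*} {T} S≼S* (S*-optimal T feasible-T)) ,
       λ (T , feasible-T , T≼S , ΦT<ΦS) → <⇒≱ ΦT<ΦS (S-Φ-least T (feasible-T , ≼-trans {T} {S} {S*} T≼S S≼S*))

  module _ {S : Solution} {i : Fin (suc k)} {U : Subset n} where

    private
      T : Solution
      T = updateAt S i (const U)

      T-elim : (P : Fin (suc k) → Subset n → Set) → P i U → (∀ i′ → i′ ≢ i → P i′ (S i′)) → ∀ i′ → P i′ (T i′)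
      T-elim = updateAt-elim S i (const U)

    replace-feasible : Feasible A p S → 0 < toℕ i →
      (∀ {j} → j ∈ U → ∀ i′ → i′ ≢ i → j ∉ S i′) → (∃ λ m → MaxIs U m × p < m) →
      Feasible A p (updateAt S i (const U))
    replace-feasible (disjoint , first , later) i>0 U-disjoint U-max = T-disjoint , T-first , T-later
      where
      ∈T⁻ : ∀ {j} i′ → j ∈ T i′ → (i′ ≡ i × j ∈ U) ⊎ (i′ ≢ i × j ∈ S i′)
      ∈T⁻ {j} = T-elim (λ i′ V → j ∈ V → (i′ ≡ i × j ∈ U) ⊎ (i′ ≢ i × j ∈ S i′))
        (λ j∈U → inj₁ (refl , j∈U)) (λ i′ i′≢i j∈ → inj₂ (i′≢i , j∈))
      T-disjoint : ∀ i₁ i₂ → i₁ ≢ i₂ → ∀ j → j ∈ T i₁ → j ∉ T i₂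
      T-disjoint i₁ i₂ i₁≢i₂ j j∈₁ j∈₂ with ∈T⁻ i₁ j∈₁ | ∈T⁻ i₂ j∈₂
      ... | inj₁ (refl , _) | inj₁ (refl , _) = i₁≢i₂ refl
      ... | inj₁ (_ , j∈U) | inj₂ (i₂≢i , j∈S) = U-disjoint j∈U i₂ i₂≢i j∈S
      ... | inj₂ (i₁≢i , j∈S) | inj₁ (_ , j∈U) = U-disjoint j∈U i₁ i₁≢i j∈S
      ... | inj₂ (_ , j∈S₁) | inj₂ (_ , j∈S₂) = disjoint i₁ i₂ i₁≢i₂ j j∈S₁ j∈S₂
      T-first : ∀ i′ → toℕ i′ ≡ 0 → MaxIs (T i′) p
      T-first = T-elim (λ i′ V → toℕ i′ ≡ 0 → MaxIs V p) (λ i≡0 → contradiction i≡0 (>⇒≢ i>0)) (λ i′ _ → first i′)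
      T-later : ∀ i′ → 0 < toℕ i′ → ∃ λ m → MaxIs (T i′) m × p < m
      T-later = T-elim (λ i′ V → 0 < toℕ i′ → ∃ λ m → MaxIs V m × p < m) (λ _ → U-max) (λ i′ _ → later i′)

    replace-improves : Feasible A p S → 0 < toℕ i →
      (∀ {j} → j ∈ U → ∀ i′ → i′ ≢ i → j ∉ S i′) → (∃ λ m → MaxIs U m × p < m) →
      Σ[ U , A ] ≤ Σ[ S i , A ] → Mn S A ≤ Σ[ U , A ] → Σ[ U , weights ] < Σ[ S i , weights ] →
      Improvement S
    replace-improves feasible i>0 U-disjoint U-max ΣU≤ΣSi Mn≤ΣU ΦU<ΦSi =
      T , replace-feasible feasible i>0 U-disjoint U-max , RatioLe-mono Mx-T≤Mx-S Mn-S≤Mn-T , Φ-T<Φ-S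
      where
      ΣS : Fin (suc k) → ℕ
      ΣS i′ = Σ[ S i′ , A ]
      Mx-T≤Mx-S : Mx T A ≤ Mx S A
      Mx-T≤Mx-S = maxF-lub (λ i′ → Σ[ T i′ , A ])
        (T-elim (λ _ V → Σ[ V , A ] ≤ Mx S A) (≤-trans ΣU≤ΣSi (maxF-ub ΣS i)) (λ i′ _ → maxF-ub ΣS i′))
      Mn-S≤Mn-T : Mn S A ≤ Mn T A
      Mn-S≤Mn-T = minF-glb (λ i′ → Σ[ T i′ , A ])
        (T-elim (λ _ V → Mn S A ≤ Σ[ V , A ]) Mn≤ΣU (λ i′ _ → minF-lb ΣS i′))
      Φ-T<Φ-S : Φ T < Φ S
      Φ-T<Φ-S = sum-tabulate-mono-<
        (T-elim (λ i′ V → Σ[ V , weights ] ≤ Σ[ S i′ , weights ]) (<⇒≤ ΦU<ΦSi) (λ _ _ → ≤-refl)) i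
        (subst (λ V → Σ[ V , weights ] < Σ[ S i , weights ]) (sym (updateAt-updates i S)) ΦU<ΦSi)

  MaxIs-⁅⁆ : (j : Fin n) → MaxIs ⁅ j ⁆ (idx j)
  MaxIs-⁅⁆ j = (j , x∈⁅x⁆ j , refl) , λ j′ j′∈ → ≤-reflexive (cong idx (x∈⁅y⁆⇒x≡y j j′∈))

  consecutive-singletons-feasible : 1 ≤ p → p + suc k ≤ n + 1 → ∃ λ (S : Solution) → Feasible A p S
  consecutive-singletons-feasible 1≤p p+k≤n+1 = S , disjoint , first , later
    where
    position< : (i : Fin (suc k)) → p ∸ 1 + toℕ i < n
    position< i = begin
      suc (p ∸ 1 + toℕ i) ≡⟨ cong (_+ toℕ i) (m+[n∸m]≡n 1≤p) ⟩
      p + toℕ i           ≤⟨ +-monoʳ-≤ p (s≤s⁻¹ (toℕ<n i)) ⟩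
      p + k               ≤⟨ s≤s⁻¹ (subst₂ _≤_ (+-suc p k) (+-comm n 1) p+k≤n+1) ⟩
      n                   ∎
      where open ≤-Reasoning
    position : Fin (suc k) → Fin n
    position i = fromℕ< (position< i)
    idx-position : ∀ i → idx (position i) ≡ p + toℕ i
    idx-position i = trans (cong suc (toℕ-fromℕ< (position< i))) (cong (_+ toℕ i) (m+[n∸m]≡n 1≤p))
    S : Solution
    S i = ⁅ position i ⁆
    disjoint : ∀ i i′ → i ≢ i′ → ∀ j → j ∈ S i → j ∉ S i′
    disjoint i i′ i≢i′ j j∈ j∈′ = i≢i′ (toℕ-injective (+-cancelˡ-≡ p _ _ (trans (sym (idx-position i))
      (trans (cong idx (trans (sym (x∈⁅y⁆⇒x≡y _ j∈)) (x∈⁅y⁆⇒x≡y _ j∈′))) (idx-position i′)))))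
    first : ∀ i → toℕ i ≡ 0 → MaxIs (S i) p
    first i i≡0 = subst (MaxIs (S i)) (trans (idx-position i) (trans (cong (p +_) i≡0) (+-identityʳ p)))
      (MaxIs-⁅⁆ (position i))
    later : ∀ i → 0 < toℕ i → ∃ λ m → MaxIs (S i) m × p < m
    later i i>0 = idx (position i) , MaxIs-⁅⁆ (position i) , subst (p <_) (sym (idx-position i)) (m<m+n p i>0)

  lookup-weights : ∀ j → lookup weights j ≡ idx j
  lookup-weights = lookup∘tabulate idx

  weight>0 : ∀ j → 0 < lookup weights j
  weight>0 j = subst (0 <_) (sym (lookup-weights j)) z<s

  module Exchanges (sorted : Sorted A) (positive : Positive A) {q : ℕ} (q-index : IsQIndex A (Qsum A p) q) where

    Q : ℕ
    Q = Qsum A p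

    prefix : Subset n
    prefix = subset (λ j → toℕ j <? p)

    Q≡Σ-prefix : Q ≡ Σ[ prefix , A ]
    Q≡Σ-prefix = sym (cong sum (trans
      (cong (λ v → zipWith (λ b x → if b then x else 0) v A) (tabulate-∘ (λ j → does (toℕ j <? p)) (λ j → j)))
      (zipWith-map₁ (λ b x → if b then x else 0) (λ j → does (toℕ j <? p)) (tabulate (λ j → j)) A)))

    Σ≤Q : ∀ {U} → (∀ {j} → j ∈ U → toℕ j < p) → Σ[ U , A ] ≤ Q
    Σ≤Q U-prefix = subst (_ ≤_) (sym Q≡Σ-prefix) (Σ-mono-⊆ A λ j∈U → ∈-subset⁺ (λ j → toℕ j <? p) (U-prefix j∈U))

    big⇒above-q : ∀ {j} → Q < lookup A j → q < idx j
    big⇒above-q {j} Q<Aj = let (jq , idx-jq≡q , Ajq≤Q) , _ = q-index in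
      ≰⇒> λ idx-j≤q → <⇒≱ Q<Aj (≤-trans (sorted j jq (s≤s⁻¹ (subst (idx j ≤_) (sym idx-jq≡q) idx-j≤q))) Ajq≤Q)

    above-q⇒big : ∀ {j} → q < idx j → Q < lookup A j
    above-q⇒big {j} q<idx-j = ≰⇒> λ Aj≤Q → <⇒≱ q<idx-j (proj₂ q-index j Aj≤Q)

    q≤n : q ≤ n
    q≤n = let (jq , idx-jq≡q , _) , _ = q-index in subst (_≤ n) idx-jq≡q (toℕ<n jq)

    BigSingleton-∈ : ∀ {U j} → BigSingleton A Q U → j ∈ U → Q < lookup A j
    BigSingleton-∈ {j = j} (j₀ , U≡⁅j₀⁆ , Q<Aj₀) j∈U rewrite x∈⁅y⁆⇒x≡y j₀ (subst (j ∈_) U≡⁅j₀⁆ j∈U) = Q<Aj₀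

    InBigSingleton : Solution → Fin n → Set
    InBigSingleton S j = ∃ λ i → BigSingleton A Q (S i) × j ∈ S i

    inBigSingleton? : ∀ S j → Dec (InBigSingleton S j)
    inBigSingleton? S j = any? λ i → bigSingleton? A Q (S i) ×-dec (j ∈? S i)

    bigElements : Solution → Subset n
    bigElements S = subset (inBigSingleton? S)

    module _ {S : Solution} (feasible : Feasible A p S) where

      private
        disjoint = proj₁ feasible
        first = proj₁ (proj₂ feasible)
        later = proj₂ (proj₂ feasible)

      same-set : ∀ {i i′ j} → j ∈ S i → j ∈ S i′ → i ≡ i′
      same-set {i} {i′} j∈ j∈′ = decidable-stable (i ≟ᶠ i′) λ i≢i′ → disjoint i i′ i≢i′ _ j∈ j∈′

      numBig≡∣bigElements∣ : numBig A Q S ≡ ∣ bigElements S ∣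
      numBig≡∣bigElements∣ = trans (count-tabulate (bigSingleton? A Q) S) (∣p∣≡∣q∣-matching R
        (λ {i} i∈ → let big@(j , Si≡⁅j⁆ , _) = ∈-subset⁻ (bigSingleton? A Q ∘ S) i∈
                        j∈ = subst (j ∈_) (sym Si≡⁅j⁆) (x∈⁅x⁆ j)
                    in j , ∈-subset⁺ (inBigSingleton? S) (i , big , j∈) , big , j∈)
        (λ j∈B → let i , big , j∈ = ∈-subset⁻ (inBigSingleton? S) j∈B
                 in i , ∈-subset⁺ (bigSingleton? A Q ∘ S) big , big , j∈)
        (λ (_ , j∈) (_ , j∈′) → same-set j∈ j∈′)
        (λ ((j₀ , Si≡⁅j₀⁆ , _) , j∈) (_ , j′∈) →
          trans (x∈⁅y⁆⇒x≡y j₀ (subst (_ ∈_) Si≡⁅j₀⁆ j∈)) (sym (x∈⁅y⁆⇒x≡y j₀ (subst (_ ∈_) Si≡⁅j₀⁆ j′∈)))))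
        where
        R : Fin (suc k) → Fin n → Set
        R i j = BigSingleton A Q (S i) × j ∈ S i

      first-Σ≤Q : ∀ {i} → toℕ i ≡ 0 → Σ[ S i , A ] ≤ Q
      first-Σ≤Q {i} i≡0 = Σ≤Q λ {j} j∈ → proj₂ (first i i≡0) j j∈

      Mn≤Q : Mn S A ≤ Q
      Mn≤Q = ≤-trans (minF-lb (λ i → Σ[ S i , A ]) fzero) (first-Σ≤Q refl)

      big⇒later : ∀ {i j} → j ∈ S i → Q < lookup A j → 0 < toℕ i
      big⇒later j∈ Q<Aj = n≢0⇒n>0 λ i≡0 → <⇒≱ Q<Aj (≤-trans (lookup≤Σ A j∈) (first-Σ≤Q i≡0))

      index-p-light : ∃ λ j → idx j ≡ p × lookup A j ≤ Q
      index-p-light = let (j , j∈ , idx-j≡p) , _ = first fzero refl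
                      in j , idx-j≡p , ≤-trans (lookup≤Σ A j∈) (first-Σ≤Q refl)

      p≤q : p ≤ q
      p≤q = let j , idx-j≡p , Aj≤Q = index-p-light in subst (_≤ q) idx-j≡p (proj₂ q-index j Aj≤Q)

      0<Q : 0 < Q
      0<Q = let j , _ , Aj≤Q = index-p-light in <-≤-trans (positive j) Aj≤Q

      Q<2*Q : Q < 2 * Q
      Q<2*Q = m<m+n Q (≤-trans 0<Q (m≤m+n Q 0))

      singleton-improves : ∀ {i j} → 0 < toℕ i → Q < lookup A j → (∀ i′ → i′ ≢ i → j ∉ S i′) →
        lookup A j ≤ Σ[ S i , A ] → idx j < Σ[ S i , weights ] → Improvement S
      singleton-improves {i} {j} i>0 Q<Aj j-elsewhere Aj≤ΣA idx-j<Σw =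
        replace-improves feasible i>0 ⁅j⁆-disjoint (idx j , MaxIs-⁅⁆ j , ≤-<-trans p≤q (big⇒above-q Q<Aj))
          (subst (_≤ Σ[ S i , A ]) (sym (Σ-⁅⁆ A j)) Aj≤ΣA)
          (subst (Mn S A ≤_) (sym (Σ-⁅⁆ A j)) (≤-trans Mn≤Q (<⇒≤ Q<Aj)))
          (subst (_< Σ[ S i , weights ]) (sym (trans (Σ-⁅⁆ weights j) (lookup-weights j))) idx-j<Σw)
        where
        ⁅j⁆-disjoint : ∀ {j′} → j′ ∈ ⁅ j ⁆ → ∀ i′ → i′ ≢ i → j′ ∉ S i′
        ⁅j⁆-disjoint j′∈⁅j⁆ rewrite x∈⁅y⁆⇒x≡y j j′∈⁅j⁆ = j-elsewhere

      heavy-improves : ∀ {i} → (∀ j → j ∈ S i → lookup A j ≤ Q) → 2 * Q ≤ Σ[ S i , A ] → Improvement S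
      heavy-improves {i} light 2Q≤Σ with toℕ i ≟ 0
      ... | yes i≡0 = contradiction (≤-trans 2Q≤Σ (first-Σ≤Q i≡0)) (<⇒≱ Q<2*Q)
      ... | no i≢0 with later i (n≢0⇒n>0 i≢0)
      ...   | m , ((e , e∈ , idx-e≡m) , e-max) , p<m with any? (λ j′ → (j′ ∈? S i) ×-dec ¬? (j′ ≟ᶠ e))
      ...     | no ¬other = contradiction (≤-trans 2Q≤Σ (≤-trans Σ≤Ae (light e e∈))) (<⇒≱ Q<2*Q)
        where
        Σ≤Ae : Σ[ S i , A ] ≤ lookup A e
        Σ≤Ae = subst (Σ[ S i , A ] ≤_) (Σ-⁅⁆ A e) (Σ-mono-⊆ A λ {j′} j′∈ →
          subst (_∈ ⁅ e ⁆) (sym (decidable-stable (j′ ≟ᶠ e) λ j′≢e → ¬other (j′ , j′∈ , j′≢e))) (x∈⁅x⁆ e))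
      ...     | yes (j′ , j′∈ , j′≢e) = replace-improves feasible (n≢0⇒n>0 i≢0)
        (λ j∈U i′ i′≢i j∈′ → i′≢i (same-set j∈′ (U⊆Si j∈U)))
        (m , ((e , x∈p∧x≢y⇒x∈p-y e∈ (j′≢e ∘ sym) , idx-e≡m) , λ j j∈U → e-max j (U⊆Si j∈U)) , p<m)
        (Σ-mono-⊆ A U⊆Si) (≤-trans Mn≤Q Q≤ΣU) (Σ-remove-< (S i) weights j′∈ (weight>0 j′))
        where
        U⊆Si : S i - j′ ⊆ S i
        U⊆Si = p─q⊆p (S i) ⁅ j′ ⁆
        Q≤ΣU : Q ≤ Σ[ S i - j′ , A ]
        Q≤ΣU = +-cancelʳ-≤ Q Q Σ[ S i - j′ , A ] (begin
          Q + Q                       ≡⟨ cong (Q +_) (+-identityʳ Q) ⟨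
          2 * Q                       ≤⟨ 2Q≤Σ ⟩
          Σ[ S i , A ]                ≡⟨ Σ-remove (S i) A j′∈ ⟩
          Σ[ S i - j′ , A ] + lookup A j′ ≤⟨ +-monoʳ-≤ Σ[ S i - j′ , A ] (light j′ j′∈) ⟩
          Σ[ S i - j′ , A ] + Q       ∎)
          where open ≤-Reasoning

      module _ (no-improvement : ¬ Improvement S) where

        light-sets : ∀ i → (∀ j → j ∈ S i → lookup A j ≤ Q) → Σ[ S i , A ] < 2 * Q
        light-sets i light with Σ[ S i , A ] <? 2 * Q
        ... | yes Σ<2Q = Σ<2Q
        ... | no Σ≮2Q = contradiction (heavy-improves light (≮⇒≥ Σ≮2Q)) no-improvement

        big-in-singleton : ∀ {i j} → j ∈ S i → Q < lookup A j → S i ≡ ⁅ j ⁆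
        big-in-singleton {i} {j} j∈ Q<Aj with any? (λ j′ → (j′ ∈? S i) ×-dec ¬? (j′ ≟ᶠ j))
        ... | yes (j′ , j′∈ , j′≢j) = contradiction
          (singleton-improves (big⇒later j∈ Q<Aj) Q<Aj (λ i′ i′≢i j∈′ → i′≢i (same-set j∈′ j∈)) (lookup≤Σ A j∈) idx-j<Σw)
          no-improvement
          where
          idx-j<Σw : idx j < Σ[ S i , weights ]
          idx-j<Σw = begin-strict
            idx j                   ≡⟨ lookup-weights j ⟨
            lookup weights j        ≤⟨ lookup≤Σ weights (x∈p∧x≢y⇒x∈p-y j∈ (j′≢j ∘ sym)) ⟩
            Σ[ S i - j′ , weights ] <⟨ Σ-remove-< (S i) weights j′∈ (weight>0 j′) ⟩
            Σ[ S i , weights ]      ∎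
            where open ≤-Reasoning
        ... | no ¬other = ⊆-antisym
          (λ {j′} j′∈ → subst (_∈ ⁅ j ⁆) (sym (decidable-stable (j′ ≟ᶠ j) λ j′≢j → ¬other (j′ , j′∈ , j′≢j))) (x∈⁅x⁆ j))
          (λ j′∈⁅j⁆ → subst (_∈ S i) (sym (x∈⁅y⁆⇒x≡y j j′∈⁅j⁆)) j∈)

        big-singletons-downClosed : ∀ {j j′} → InBigSingleton S j → q ≤ toℕ j′ → toℕ j′ < toℕ j → InBigSingleton S j′
        big-singletons-downClosed {j} {j′} (i , big , j∈) q≤j′ j′<j with inBigSingleton? S j′
        ... | yes j′-in = j′-in
        ... | no j′-out = contradiction
          (singleton-improves (big⇒later j∈ Q<Aj) Q<Aj′ j′-elsewhere
            (≤-trans (sorted j′ j (<⇒≤ j′<j)) (lookup≤Σ A j∈))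
            (<-≤-trans (s≤s j′<j) (subst (_≤ Σ[ S i , weights ]) (lookup-weights j) (lookup≤Σ weights j∈))))
          no-improvement
          where
          Q<Aj = BigSingleton-∈ big j∈
          Q<Aj′ = above-q⇒big (s≤s q≤j′)
          j′-elsewhere : ∀ i′ → i′ ≢ i → j′ ∉ S i′
          j′-elsewhere i′ _ j′∈ = j′-out (i′ , (j′ , big-in-singleton j′∈ Q<Aj′ , Q<Aj′) , j′∈)

        bigElements-interval : q + ∣ bigElements S ∣ ≤ n ×
          (∀ j → j ∈ bigElements S ⇔ (q ≤ toℕ j × toℕ j < q + ∣ bigElements S ∣))
        bigElements-interval = interval-of-downClosed (bigElements S) q q≤n
          (λ j∈B → let _ , big , j∈ = ∈-subset⁻ (inBigSingleton? S) j∈B in s≤s⁻¹ (big⇒above-q (BigSingleton-∈ big j∈)))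
          (λ j∈B q≤j′ j′<j → ∈-subset⁺ (inBigSingleton? S)
            (big-singletons-downClosed (∈-subset⁻ (inBigSingleton? S) j∈B) q≤j′ j′<j))

        big-singletons-interval : q + numBig A Q S ≤ n ×
          (∀ j → InBigSingleton S j ⇔ (q < idx j × idx j ≤ q + numBig A Q S))
        big-singletons-interval rewrite numBig≡∣bigElements∣ =
          let size , interval = bigElements-interval
          in size , λ j → mk⇔
            (λ j-in → let q≤j , j<q+x = Equivalence.to (interval j) (∈-subset⁺ (inBigSingleton? S) j-in)
                      in s≤s q≤j , j<q+x)
            (λ (q<idx-j , idx-j≤q+x) →
              ∈-subset⁻ (inBigSingleton? S) (Equivalence.from (interval j) (s≤s⁻¹ q<idx-j , idx-j≤q+x)))

theorem9 : (k : ℕ) → 2 ≤ k → (n : ℕ) → (A : Vec ℕ n) → Sorted A → Positive A →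
    (p : ℕ) → 1 ≤ p → p + k ≤ n + 1 →
    (q : ℕ) → IsQIndex A (Qsum A p) q →
    ∃ λ (S : Fin k → Subset n) → Optimal A p S
      × ((i : Fin k) → ((j : Fin n) → j ∈ S i → lookup A j ≤ Qsum A p)
           → Σ[ S i , A ] < 2 * Qsum A p)
      × ((i : Fin k) → (∃ λ (j : Fin n) → j ∈ S i × Qsum A p < lookup A j)
           → ∃ λ (j : Fin n) → S i ≡ ⁅ j ⁆)
      × (q + numBig A (Qsum A p) S ≤ n)
      × ((j : Fin n) → (∃ λ (i : Fin k) → BigSingleton A (Qsum A p) (S i) × j ∈ S i)
           ⇔ (q < idx j × idx j ≤ q + numBig A (Qsum A p) S))
theorem9 zero () n A sorted positive p 1≤p p+k≤n+1 q q-index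
theorem9 (suc k) _ n A sorted positive p 1≤p p+k≤n+1 q q-index =
  let S₀ , feasible-S₀ = consecutive-singletons-feasible 1≤p p+k≤n+1
      S , optimal , no-improvement = optimal-without-improvement feasible-S₀
      feasible = proj₁ optimal
  in S , optimal , light-sets feasible no-improvement ,
     (λ i (j , j∈ , Q<Aj) → j , big-in-singleton feasible no-improvement j∈ Q<Aj) ,
     big-singletons-interval feasible no-improvement
  where
  open Instance {k = k} A p
  open Exchanges sorted positive q-index
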